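{- Let $L$ be a degree assignment for a graph $G$. Fix $v,w,x\in V(G)$ such that $v,x\in N(w)$, $vx\notin E(G)$, and $G-v-x$ is connected. If there exists $\alpha\in L(v)\cap L(x)$, then $\mathcal{L}_{v,\alpha}\cap\mathcal{L}_{x,\alpha}$ mixes.
   Context: A list assignment $L$ assigns to each vertex $v$ a set $L(v)$ of colors; it is a degree assignment if $|L(v)|=d(v)$ for all $v$. An $L$-coloring is a proper coloring $\varphi$ with $\varphi(v)\in L(v)$ for all $v$. An $\alpha,\beta$-Kempe swap interchanges colors $\alpha,\beta$ on one connected component of the subgraph induced by vertices colored $\alpha$ or $\beta$; it is $L$-valid for $\varphi$ if the result is again an $L$-coloring. Two $L$-colorings are $L$-equivalent if one can be transformed into the other by a sequence of $L$-valid Kempe swaps (through arbitrary $L$-colorings of $G$). A set $\mathcal{L}'$ of $L$-colorings of $G$ mixes if every two colorings in $\mathcal{L}'$ are $L$-equivalent. $\mathcal{L}_{u,\alpha}$ denotes the set of all $L$-colorings $\varphi$ of $G$ with $\varphi(u)=\alpha$. -}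

module Defs where

open import Data.Nat using (ℕ)
open import Data.Fin using (Fin)
open import Data.Bool using (Bool; true; false)
open import Data.List using (List; length; filterᵇ)
open import Data.List.Membership.Propositional using (_∈_)
open import Data.List.Relation.Unary.Unique.Propositional using (Unique)
open import Data.List.Base using () renaming (allFin to allFinL)
open import Data.Product using (Σ; _×_; ∃)
open import Data.Sum using (_⊎_)
open import Relation.Nullary using (¬_; Dec; yes; no)
open import Relation.Binary.PropositionalEquality using (_≡_; _≢_)
open import Relation.Binary.Construct.Closure.ReflexiveTransitive using (Star)
open import Data.Nat using (_≟_)

record Graph (n : ℕ) : Set where
  field
    E      : Fin n → Fin n → Bool
    sym    : ∀ u v → E u v ≡ E v u
    irrefl : ∀ v → E v v ≡ false
open Graph public

module _ {n : ℕ} (G : Graph n) where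

  Adj : Fin n → Fin n → Set
  Adj u v = E G u v ≡ true

  deg : Fin n → ℕ
  deg v = length (filterᵇ (E G v) (allFinL n))

  -- colors are natural numbers; a list assignment gives each vertex a
  -- duplicate-free list (i.e. a finite set) of colors
  ListAssignment : Set
  ListAssignment = Fin n → List ℕ

  IsDegreeAssignment : ListAssignment → Set
  IsDegreeAssignment L = ∀ v → Unique (L v) × length (L v) ≡ deg v

  Coloring : Set
  Coloring = Fin n → ℕ

  IsProper : Coloring → Set
  IsProper φ = ∀ u v → Adj u v → φ u ≢ φ v

  IsLColoring : ListAssignment → Coloring → Set
  IsLColoring L φ = IsProper φ × (∀ v → φ v ∈ L v)

  InAB : Coloring → ℕ → ℕ → Fin n → Set
  InAB φ α β v = φ v ≡ α ⊎ φ v ≡ β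

  -- Reach φ α β s t : t lies in the component containing s of the subgraph
  -- induced by the vertices colored α or β
  data Reach (φ : Coloring) (α β : ℕ) (s : Fin n) : Fin n → Set where
    here : InAB φ α β s → Reach φ α β s s
    step : ∀ {u t} → Reach φ α β s u → Adj u t → InAB φ α β t → Reach φ α β s t

  swapColor : ℕ → ℕ → ℕ → ℕ
  swapColor α β c with c ≟ α
  ... | yes _ = β
  ... | no _ with c ≟ β
  ...   | yes _ = α
  ...   | no _ = c

  KempeSwap : Coloring → Coloring → Set
  KempeSwap φ ψ = Σ ℕ λ α → Σ ℕ λ β → Σ (Fin n) λ s →
    (∀ v → Reach φ α β s v → ψ v ≡ swapColor α β (φ v)) ×
    (∀ v → ¬ Reach φ α β s v → ψ v ≡ φ v)

  LKempeStep : ListAssignment → Coloring → Coloring → Set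
  LKempeStep L φ ψ = IsLColoring L φ × IsLColoring L ψ × KempeSwap φ ψ

  LEquivalent : ListAssignment → Coloring → Coloring → Set
  LEquivalent L = Star (LKempeStep L)

  Mixes : ListAssignment → (Coloring → Set) → Set
  Mixes L S = ∀ φ ψ → IsLColoring L φ → IsLColoring L ψ → S φ → S ψ →
              LEquivalent L φ ψ

  𝓛 : ListAssignment → Fin n → ℕ → Coloring → Set
  𝓛 L u α φ = IsLColoring L φ × φ u ≡ α

  data PathIn (S : Fin n → Set) (a : Fin n) : Fin n → Set where
    here : S a → PathIn S a a
    step : ∀ {u t} → PathIn S a u → Adj u t → S t → PathIn S a t

  ConnectedOn : (Fin n → Set) → Set
  ConnectedOn S = ∀ a b → S a → S b → PathIn S a b

  Minus2 : Fin n → Fin n → Fin n → Set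
  Minus2 v x u = u ≢ v × u ≢ x

-- Color v and x with α and consider, for S ⊆ V − {v, x}, the L-colorings of G[S ∪ {v, x}] that
-- give v and x the color α; vertices outside S ∪ {v, x} count as deleted.  A vertex w ∈ S has
-- slack if it has a deleted neighbor or is adjacent to both v and x (which share one color):
-- then, L being a degree assignment, the colors on the kept neighbors of w other than one fixed
-- neighbor y, together with one further color, cannot exhaust L(w).  Since G − v − x is connected,
-- every vertex of S reaches a slack vertex inside S, so S can be emptied one slack vertex at a
-- time, and we show by induction that all such colorings are Kempe equivalent using swaps inside
-- S.  A swap of G[S − w] on a βγ-chain lifts to G[S]: if w is colored β or γ and adjacent to the
-- chain through y, then either w first moves to a color free at w outside {β, γ}, or, by the
-- count above, y is the only kept neighbor of w with the other color of the pair and the chain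
-- extended by w is swapped.  Finally w is recolored to agree with the target coloring.  Swaps
-- inside V − {v, x} between colorings that are proper on all of G are genuine Kempe swaps of G.

module Submission where

open import Defs hiding (sym)
open import Data.Nat using (ℕ; _≤_; _<_; s≤s; z≤n)
import Data.Nat as ℕ
open import Data.Nat.Properties using (<-≤-trans; <-irrefl; module ≤-Reasoning)
open import Data.Nat.Induction using (<-wellFounded)
open import Induction.WellFounded using (Acc; acc)
open import Data.Bool using (true; false; T) renaming (_≟_ to _≟ᵇ_)
open import Data.Unit using (tt)
open import Data.Fin using (Fin) renaming (_≟_ to _≟ᶠ_)
open import Data.Fin.Properties using (any?)
open import Data.Fin.Subset using (Subset; inside; outside; ⊤; ⁅_⁆; _-_; _─_; _∪_; ∣_∣)
  renaming (_∈_ to _∈ₛ_; _∉_ to _∉ₛ_; _⊆_ to _⊆ₛ_)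
open import Data.Fin.Subset.Properties using (∈⊤; x∈⁅x⁆; x∈⁅y⁆⇒x≡y; x∈p∪q⁺; x∈p∪q⁻; p─q⊆p;
  x∈p∧x≢y⇒x∈p-y; x∈p⇒∣p-x∣<∣p∣; nonempty?) renaming (_∈?_ to _∈ₛ?_)
open import Data.Vec using (_∷_; here; there)
open import Data.Vec.Functional using (updateAt)
open import Data.Vec.Functional.Properties using (updateAt-updates; updateAt-minimal)
open import Data.Product using (_×_; _,_; proj₁; proj₂; ∃)
open import Data.Sum using (_⊎_; inj₁; inj₂)
open import Data.Empty using (⊥-elim)
open import Function using (_∘_)
open import Data.List using (List; []; _∷_; length; map; filter; filterᵇ)
open import Data.List.Base using () renaming (allFin to allFinL)
open import Data.List.Membership.Propositional using (_∈_; find; lose)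
open import Data.List.Membership.DecPropositional ℕ._≟_ using (_∈?_)
open import Data.List.Membership.Propositional.Properties using (∈-filter⁺; ∈-map⁺; ∈-allFin)
open import Data.List.Properties using (filter-notAll; length-map)
open import Data.List.Relation.Unary.Any using (Any; here; there)
import Data.List.Relation.Unary.Any as Any
open import Data.List.Relation.Unary.AllPairs using (_∷_)
import Data.List.Relation.Unary.All as All
open import Data.List.Relation.Unary.Unique.Propositional using (Unique)
open import Relation.Nullary using (¬_; Dec; yes; no; contradiction; T?)
open import Relation.Nullary.Decidable using (¬?; _×-dec_; _⊎-dec_; decidable-stable)
open import Relation.Binary.Definitions using (DecidableEquality)
open import Relation.Binary.PropositionalEquality
  using (_≡_; _≢_; refl; sym; trans; cong; subst; ≢-sym; module ≡-Reasoning)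
open import Relation.Binary.Construct.Closure.ReflexiveTransitive using (Star; ε; _◅_; _◅◅_)
  renaming (map to Star-map)

∈⇒Any¬¬≡ : ∀ {A : Set} {a : A} {zs} → a ∈ zs → Any (λ y → ¬ ¬ (y ≡ a)) zs
∈⇒Any¬¬≡ = Any.map λ a≡y y≢a → y≢a (sym a≡y)

Unique⇒length≤ : ∀ {A : Set} → DecidableEquality A → ∀ {xs ys : List A} → Unique xs →
                 (∀ {e} → e ∈ xs → e ∈ ys) → length xs ≤ length ys
Unique⇒length≤ _≟_ {[]}     _           _     = z≤n
Unique⇒length≤ _≟_ {a ∷ xs} {ys} (a∉xs ∷ u) xs⊆ys =
  <-≤-trans (s≤s (Unique⇒length≤ _≟_ u xs⊆ys-a)) (filter-notAll _ ys (∈⇒Any¬¬≡ (xs⊆ys (here refl))))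
  where
  xs⊆ys-a : ∀ {e} → e ∈ xs → e ∈ filter (λ y → ¬? (y ≟ a)) ys
  xs⊆ys-a e∈xs = ∈-filter⁺ _ (xs⊆ys (there e∈xs)) λ e≡a → All.lookup a∉xs e∈xs (sym e≡a)

x∈p─q⇒x∉q : ∀ {n} {x : Fin n} (p q : Subset n) → x ∈ₛ p ─ q → x ∉ₛ q
x∈p─q⇒x∉q (inside ∷ p) (outside ∷ q) here ()
x∈p─q⇒x∉q (_ ∷ p) (_ ∷ q) (there x∈p─q) (there x∈q) = x∈p─q⇒x∉q p q x∈p─q x∈q

x∈p-y⇒x≢y : ∀ {n} {x y : Fin n} (p : Subset n) → x ∈ₛ p - y → x ≢ y
x∈p-y⇒x≢y {y = y} p x∈p-y refl = x∈p─q⇒x∉q p ⁅ y ⁆ x∈p-y (x∈⁅x⁆ y)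

module _ {n : ℕ} (G : Graph n) where

  Adj-sym : ∀ {u t} → Adj G u t → Adj G t u
  Adj-sym {u} {t} = trans (Graph.sym G t u)

  Adj⇒≢ : ∀ {u t} → Adj G u t → u ≢ t
  Adj⇒≢ {u} Euu refl with trans (sym (irrefl G u)) Euu
  ... | ()

  Adj? : ∀ u t → Dec (Adj G u t)
  Adj? u t = E G u t ≟ᵇ true

  InAB? : ∀ φ β γ t → Dec (InAB G φ β γ t)
  InAB? φ β γ t = (φ t ℕ.≟ β) ⊎-dec (φ t ℕ.≟ γ)

  PathIn-map : ∀ {P Q : Fin n → Set} → (∀ {t} → P t → Q t) →
               ∀ {a b} → PathIn G P a b → PathIn G Q a b
  PathIn-map f (here p)     = here (f p)
  PathIn-map f (step r a p) = step (PathIn-map f r) a (f p)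

  PathIn-last : ∀ {P : Fin n → Set} {a b} → PathIn G P a b → P b
  PathIn-last (here p)     = p
  PathIn-last (step _ _ p) = p

  path-avoiding-or-hitting : ∀ {S : Subset n} {w u t} → PathIn G (_∈ₛ S) u t → u ∈ₛ S - w →
    PathIn G (_∈ₛ S - w) u t ⊎ ∃ λ y → PathIn G (_∈ₛ S - w) u y × Adj G y w
  path-avoiding-or-hitting (here _) u∈S-w = inj₁ (here u∈S-w)
  path-avoiding-or-hitting {w = w} (step {t = t} p yt t∈S) u∈S-w
    with path-avoiding-or-hitting p u∈S-w
  ... | inj₂ hit = inj₂ hit
  ... | inj₁ p′ with t ≟ᶠ w
  ...   | yes refl = inj₂ (_ , p′ , yt)
  ...   | no t≢w   = inj₁ (step p′ yt (x∈p∧x≢y⇒x∈p-y t∈S t≢w))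

  module _ (a b : ℕ) where

    private
      sw : ℕ → ℕ
      sw = swapColor G a b

    swap-left : sw a ≡ b
    swap-left with a ℕ.≟ a
    ... | yes _  = refl
    ... | no a≢a = contradiction refl a≢a

    swap-right : sw b ≡ a
    swap-right with b ℕ.≟ a
    ... | yes b≡a = b≡a
    ... | no _ with b ℕ.≟ b
    ...   | yes _  = refl
    ...   | no b≢b = contradiction refl b≢b

    swap-fresh : ∀ {c} → c ≢ a → c ≢ b → sw c ≡ c
    swap-fresh {c} c≢a c≢b with c ℕ.≟ a
    ... | yes c≡a = contradiction c≡a c≢a
    ... | no _ with c ℕ.≟ b
    ...   | yes c≡b = contradiction c≡b c≢b
    ...   | no _    = refl

    swap-involutive : ∀ c → sw (sw c) ≡ c
    swap-involutive c with c ℕ.≟ a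
    ... | yes refl = swap-right
    ... | no c≢a with c ℕ.≟ b
    ...   | yes refl = swap-left
    ...   | no c≢b   = swap-fresh c≢a c≢b

    swap-injective : ∀ {c d} → sw c ≡ sw d → c ≡ d
    swap-injective {c} {d} eq =
      trans (sym (swap-involutive c)) (trans (cong sw eq) (swap-involutive d))

    swap-preserves-pair : ∀ {c} → c ≡ a ⊎ c ≡ b → sw c ≡ a ⊎ sw c ≡ b
    swap-preserves-pair (inj₁ refl) = inj₂ swap-left
    swap-preserves-pair (inj₂ refl) = inj₁ swap-right

    swap-other : ∀ {c d} → c ≡ a ⊎ c ≡ b → d ≡ a ⊎ d ≡ b → d ≢ c → d ≡ sw c
    swap-other (inj₁ refl) (inj₁ refl) d≢c = contradiction refl d≢c
    swap-other (inj₁ refl) (inj₂ refl) _   = sym swap-left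
    swap-other (inj₂ refl) (inj₁ refl) _   = sym swap-right
    swap-other (inj₂ refl) (inj₂ refl) d≢c = contradiction refl d≢c

  swap-diagonal : ∀ a c → swapColor G a a c ≡ c
  swap-diagonal a c with c ℕ.≟ a
  ... | yes c≡a = sym c≡a
  ... | no _ with c ℕ.≟ a
  ...   | yes c≡a = sym c≡a
  ...   | no _    = refl

  KempeSwap-≗ : ∀ {φ ψ} → Fin n → (∀ t → ψ t ≡ φ t) → KempeSwap G φ ψ
  KempeSwap-≗ {φ} s ψ≗φ =
    0 , 0 , s , (λ t _ → trans (ψ≗φ t) (sym (swap-diagonal 0 (φ t)))) , (λ t _ → ψ≗φ t)

_[_≔_] : ∀ {n} {A : Set} → (Fin n → A) → Fin n → A → Fin n → A
φ [ w ≔ e ] = updateAt φ w (λ _ → e)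

module _ {n : ℕ} (G : Graph n) (L : ListAssignment G) (L-deg : IsDegreeAssignment G L) where

  degree-list-not-covered :
    ∀ (w y z : Fin n) (c : ℕ) (f : Coloring G) → Adj G w y → Adj G w z → z ≢ y →
    ¬ (∀ {e} → e ∈ L w → e ≡ c ⊎ ∃ λ t → Adj G w t × t ≢ y × t ≢ z × f t ≡ e)
  degree-list-not-covered w y z c f wy wz z≢y covered =
    <-irrefl (proj₂ (L-deg w)) (begin-strict
      length (L w)       ≤⟨ Unique⇒length≤ ℕ._≟_ (proj₁ (L-deg w)) L⊆ ⟩
      length (map g N-y) ≡⟨ length-map g N-y ⟩
      length N-y         <⟨ filter-notAll _ N (∈⇒Any¬¬≡ (∈N wy)) ⟩
      deg G w            ∎)
    where
    open ≤-Reasoning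
    N : List (Fin n)
    N = filterᵇ (E G w) (allFinL n)
    N-y : List (Fin n)
    N-y = filter (λ t → ¬? (t ≟ᶠ y)) N
    g : Coloring G
    g = f [ z ≔ c ]
    ∈N : ∀ {t} → Adj G w t → t ∈ N
    ∈N {t} wt = ∈-filter⁺ (λ t → T? (E G w t)) (∈-allFin t) (subst T (sym wt) tt)
    g-∈ : ∀ {t} → Adj G w t → t ≢ y → g t ∈ map g N-y
    g-∈ wt t≢y = ∈-map⁺ g (∈-filter⁺ _ (∈N wt) t≢y)
    L⊆ : ∀ {e} → e ∈ L w → e ∈ map g N-y
    L⊆ e∈L with covered e∈L
    ... | inj₁ refl = subst (_∈ map g N-y) (updateAt-updates z f) (g-∈ wz z≢y)
    ... | inj₂ (t , wt , t≢y , t≢z , refl) =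
      subst (_∈ map g N-y) (updateAt-minimal t z f t≢z) (g-∈ wt t≢y)

module Pinned {n : ℕ} (G : Graph n) (L : ListAssignment G) (L-deg : IsDegreeAssignment G L)
               (v x : Fin n) (v≢x : v ≢ x) (α : ℕ) where

  Kept : Subset n → Fin n → Set
  Kept S u = u ≡ v ⊎ u ≡ x ⊎ u ∈ₛ S

  Kept? : ∀ S u → Dec (Kept S u)
  Kept? S u = (u ≟ᶠ v) ⊎-dec (u ≟ᶠ x) ⊎-dec (u ∈ₛ? S)

  Kept-mono : ∀ {S S′ u} → S′ ⊆ₛ S → Kept S′ u → Kept S u
  Kept-mono S′⊆S (inj₂ (inj₂ u∈S′)) = inj₂ (inj₂ (S′⊆S u∈S′))
  Kept-mono S′⊆S (inj₁ u≡v)         = inj₁ u≡v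
  Kept-mono S′⊆S (inj₂ (inj₁ u≡x))  = inj₂ (inj₁ u≡x)

  Kept-remove : ∀ {S u w} → Kept S u → u ≢ w → Kept (S - w) u
  Kept-remove (inj₂ (inj₂ u∈S)) u≢w = inj₂ (inj₂ (x∈p∧x≢y⇒x∈p-y u∈S u≢w))
  Kept-remove (inj₁ u≡v)        _   = inj₁ u≡v
  Kept-remove (inj₂ (inj₁ u≡x)) _   = inj₂ (inj₁ u≡x)

  Deleted : Subset n → Fin n → Set
  Deleted S u = u ∉ₛ S × u ≢ v × u ≢ x

  Kept⇒≢Deleted : ∀ {S u z} → Kept S u → Deleted S z → u ≢ z
  Kept⇒≢Deleted (inj₁ refl)        (_ , z≢v , _)   refl = z≢v refl
  Kept⇒≢Deleted (inj₂ (inj₁ refl)) (_ , _ , z≢x)   refl = z≢x refl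
  Kept⇒≢Deleted (inj₂ (inj₂ u∈S))  (z∉S , _ , _)   refl = z∉S u∈S

  Avoids : Subset n → Set
  Avoids S = v ∉ₛ S × x ∉ₛ S

  module _ {S : Subset n} (avoids : Avoids S) {u : Fin n} (u∈S : u ∈ₛ S) where

    ∈⇒≢v : u ≢ v
    ∈⇒≢v refl = proj₁ avoids u∈S

    ∈⇒≢x : u ≢ x
    ∈⇒≢x refl = proj₂ avoids u∈S

  record IsPinned (S : Subset n) (φ : Coloring G) : Set where
    field
      v↦α     : φ v ≡ α
      x↦α     : φ x ≡ α
      proper  : ∀ {u t} → Adj G u t → Kept S u → Kept S t → φ u ≢ φ t
      in-list : ∀ {u} → Kept S u → φ u ∈ L u
  open IsPinned

  IsPinned-antitone : ∀ {S S′ φ} → S′ ⊆ₛ S → IsPinned S φ → IsPinned S′ φ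
  IsPinned-antitone S′⊆S p = record
    { v↦α     = v↦α p
    ; x↦α     = x↦α p
    ; proper  = λ ut ku kt → proper p ut (Kept-mono S′⊆S ku) (Kept-mono S′⊆S kt)
    ; in-list = λ ku → in-list p (Kept-mono S′⊆S ku)
    }

  SeenAt : Subset n → Coloring G → Fin n → ℕ → Set
  SeenAt S φ w e = ∃ λ t → Adj G w t × Kept S t × φ t ≡ e

  SeenAt? : ∀ S φ w e → Dec (SeenAt S φ w e)
  SeenAt? S φ w e = any? λ t → Adj? G w t ×-dec Kept? S t ×-dec (φ t ℕ.≟ e)

  IsPinned-recolor : ∀ {S w φ e} → Avoids S → w ∈ₛ S → IsPinned (S - w) φ → e ∈ L w →
                     ¬ SeenAt S φ w e → IsPinned S (φ [ w ≔ e ])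
  IsPinned-recolor {S} {w} {φ} {e} avoids w∈S p e∈L fresh = record
    { v↦α     = trans (updateAt-minimal v w φ (≢-sym (∈⇒≢v avoids w∈S))) (v↦α p)
    ; x↦α     = trans (updateAt-minimal x w φ (≢-sym (∈⇒≢x avoids w∈S))) (x↦α p)
    ; proper  = proper′
    ; in-list = in-list′
    }
    where
    proper′ : ∀ {u t} → Adj G u t → Kept S u → Kept S t → (φ [ w ≔ e ]) u ≢ (φ [ w ≔ e ]) t
    proper′ {u} {t} ut ku kt with u ≟ᶠ w | t ≟ᶠ w
    ... | yes refl | yes refl = contradiction refl (Adj⇒≢ G ut)
    ... | yes refl | no t≢w = λ eq →
      fresh (t , ut , kt , sym (trans (sym (updateAt-updates w φ)) (trans eq (updateAt-minimal t w φ t≢w))))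
    ... | no u≢w | yes refl = λ eq →
      fresh (u , Adj-sym G ut , ku , trans (sym (updateAt-minimal u w φ u≢w)) (trans eq (updateAt-updates w φ)))
    ... | no u≢w | no t≢w = λ eq →
      proper p ut (Kept-remove ku u≢w) (Kept-remove kt t≢w)
        (trans (sym (updateAt-minimal u w φ u≢w)) (trans eq (updateAt-minimal t w φ t≢w)))
    in-list′ : ∀ {u} → Kept S u → (φ [ w ≔ e ]) u ∈ L u
    in-list′ {u} ku with u ≟ᶠ w
    ... | yes refl = subst (_∈ L u) (sym (updateAt-updates w φ)) e∈L
    ... | no u≢w   = subst (_∈ L u) (sym (updateAt-minimal u w φ u≢w)) (in-list p (Kept-remove ku u≢w))

  resp-pair : ∀ {β γ c d : ℕ} → c ≡ d → c ≡ β ⊎ c ≡ γ → d ≡ β ⊎ d ≡ γ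
  resp-pair {β} {γ} = subst (λ c → c ≡ β ⊎ c ≡ γ)

  Chain : Subset n → Coloring G → ℕ → ℕ → Fin n → Fin n → Set
  Chain S φ β γ = PathIn G (λ t → t ∈ₛ S × InAB G φ β γ t)

  Chain-transfer : ∀ {S S′ φ ψ β γ s t} → S′ ⊆ₛ S → (∀ {u} → u ∈ₛ S′ → φ u ≡ ψ u) →
                   Chain S′ φ β γ s t → Chain S ψ β γ s t
  Chain-transfer S′⊆S φ≡ψ =
    PathIn-map G λ (u∈S′ , ab) → S′⊆S u∈S′ , resp-pair (φ≡ψ u∈S′) ab

  -- K is the βγ-chain of s in G[S], carried explicitly so that membership in it is decidable
  record SwapIn (S : Subset n) (φ ψ : Coloring G) : Set where
    field
      β γ     : ℕ
      s       : Fin n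
      s∈S     : s ∈ₛ S
      K       : Subset n
      K⇒chain : ∀ {t} → t ∈ₛ K → Chain S φ β γ s t
      chain⇒K : ∀ {t} → Chain S φ β γ s t → t ∈ₛ K
      on-K    : ∀ {t} → t ∈ₛ K → ψ t ≡ swapColor G β γ (φ t)
      off-K   : ∀ {t} → t ∉ₛ K → ψ t ≡ φ t

  StepIn : Subset n → Coloring G → Coloring G → Set
  StepIn S φ ψ = IsPinned S φ × IsPinned S ψ × SwapIn S φ ψ

  EquivIn : Subset n → Coloring G → Coloring G → Set
  EquivIn S = Star (StepIn S)

  recolor-step : ∀ {S w Θ e} → Avoids S → w ∈ₛ S → IsPinned S Θ → e ∈ L w → ¬ SeenAt S Θ w e →
                 StepIn S Θ (Θ [ w ≔ e ])
  recolor-step {S} {w} {Θ} {e} avoids w∈S p e∈L fresh =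
    p , IsPinned-recolor avoids w∈S (IsPinned-antitone (p─q⊆p S ⁅ w ⁆) p) e∈L fresh , record
      { β = Θ w ; γ = e ; s = w ; s∈S = w∈S ; K = ⁅ w ⁆
      ; K⇒chain = λ t∈⁅w⁆ → subst (Chain S Θ (Θ w) e w) (sym (x∈⁅y⁆⇒x≡y w t∈⁅w⁆)) (here (w∈S , inj₁ refl))
      ; chain⇒K = λ c → subst (_∈ₛ ⁅ w ⁆) (sym (chain-trivial c)) (x∈⁅x⁆ w)
      ; on-K    = λ t∈⁅w⁆ → on (x∈⁅y⁆⇒x≡y w t∈⁅w⁆)
      ; off-K   = λ t∉⁅w⁆ → updateAt-minimal _ w Θ λ t≡w → t∉⁅w⁆ (subst (_∈ₛ ⁅ w ⁆) (sym t≡w) (x∈⁅x⁆ w))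
      }
    where
    chain-trivial : ∀ {t} → Chain S Θ (Θ w) e w t → t ≡ w
    chain-trivial (here _) = refl
    chain-trivial (step c ut (t∈S , ab)) with chain-trivial c
    ... | refl with ab
    ...   | inj₁ Θt≡Θw = ⊥-elim (proper p ut (inj₂ (inj₂ w∈S)) (inj₂ (inj₂ t∈S)) (sym Θt≡Θw))
    ...   | inj₂ Θt≡e  = ⊥-elim (fresh (_ , ut , inj₂ (inj₂ t∈S) , Θt≡e))
    on : ∀ {t} → t ≡ w → (Θ [ w ≔ e ]) t ≡ swapColor G (Θ w) e (Θ t)
    on refl = trans (updateAt-updates w Θ) (sym (swap-left G (Θ w) e))

  Slack : Subset n → Fin n → Set
  Slack S z = (∃ λ t → Adj G z t × Deleted S t) ⊎ (Adj G z v × Adj G z x)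

  record Spare (S : Subset n) (Θ : Coloring G) (w y z : Fin n) : Set where
    field
      adjacent : Adj G w z
      distinct : z ≢ y
      relocate : ∀ {t} → Adj G w t → Kept S t → t ≢ y →
                 ∃ λ t′ → Adj G w t′ × t′ ≢ y × t′ ≢ z × Θ t′ ≡ Θ t

  slack⇒spare : ∀ {S Θ w y} → Avoids S → IsPinned S Θ → y ∈ₛ S → Slack S w → ∃ (Spare S Θ w y)
  slack⇒spare avoids p y∈S (inj₁ (z , wz , z-del@(z∉S , _))) = z , record
    { adjacent = wz
    ; distinct = λ { refl → z∉S y∈S }
    ; relocate = λ wt kt t≢y → _ , wt , t≢y , Kept⇒≢Deleted kt z-del , refl
    }
  slack⇒spare {S} {Θ} {w} {y} avoids p y∈S (inj₂ (wv , wx)) = v , record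
    { adjacent = wv
    ; distinct = ≢-sym (∈⇒≢v avoids y∈S)
    ; relocate = relocate
    }
    where
    relocate : ∀ {t} → Adj G w t → Kept S t → t ≢ y → ∃ λ t′ → Adj G w t′ × t′ ≢ y × t′ ≢ v × Θ t′ ≡ Θ t
    relocate {t} wt _ t≢y with t ≟ᶠ v
    ... | yes refl = x , wx , ≢-sym (∈⇒≢x avoids y∈S) , ≢-sym v≢x , trans (x↦α p) (sym (v↦α p))
    ... | no t≢v   = t , wt , t≢y , t≢v , refl

  Saturated : Subset n → Coloring G → (w : Fin n) (c o : ℕ) → Set
  Saturated S Θ w c o = ∀ {e} → e ∈ L w → e ≢ c → e ≢ o → SeenAt S Θ w e

  free-color-or-saturated : ∀ S Θ w c o →
    (∃ λ e → e ∈ L w × ¬ SeenAt S Θ w e × e ≢ c × e ≢ o) ⊎ Saturated S Θ w c o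
  free-color-or-saturated S Θ w c o
    with Any.any? (λ e → ¬? (SeenAt? S Θ w e) ×-dec ¬? (e ℕ.≟ c) ×-dec ¬? (e ℕ.≟ o)) (L w)
  ... | yes some = inj₁ (find some)
  ... | no none  = inj₂ λ e∈L e≢c e≢o →
    decidable-stable (SeenAt? S Θ w _) λ unseen → none (lose e∈L (unseen , e≢c , e≢o))

  module Saturation {S Θ w y z c} (wy : Adj G w y) (spare : Spare S Θ w y z)
                    (saturated : Saturated S Θ w c (Θ y)) where

    private
      open Spare spare

      Covered : Set
      Covered = ∀ {e} → e ∈ L w → e ≡ c ⊎ ∃ λ t → Adj G w t × t ≢ y × t ≢ z × Θ t ≡ e

      ¬covered : ¬ Covered
      ¬covered = degree-list-not-covered G L L-deg w y z c Θ wy adjacent distinct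

      relocate-≡ : ∀ {t e} → Adj G w t → Kept S t → t ≢ y → Θ t ≡ e →
                   ∃ λ t′ → Adj G w t′ × t′ ≢ y × t′ ≢ z × Θ t′ ≡ e
      relocate-≡ wt kt t≢y refl = relocate wt kt t≢y

      covered-off : ∀ {e} → e ∈ L w → e ≢ c → e ≢ Θ y →
                    ∃ λ t → Adj G w t × t ≢ y × t ≢ z × Θ t ≡ e
      covered-off e∈L e≢c e≢Θy with saturated e∈L e≢c e≢Θy
      ... | t , wt , kt , Θt≡e = relocate-≡ wt kt (λ { refl → e≢Θy (sym Θt≡e) }) Θt≡e

    saturated⇒∈L : Θ y ∈ L w
    saturated⇒∈L with Θ y ∈? L w
    ... | yes Θy∈L = Θy∈L
    ... | no Θy∉L  = ⊥-elim (¬covered covered)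
      where
      covered : Covered
      covered {e} e∈L with e ℕ.≟ c
      ... | yes e≡c = inj₁ e≡c
      ... | no e≢c  = inj₂ (covered-off e∈L e≢c λ { refl → Θy∉L e∈L })

    saturated⇒unique : ∀ {t} → Adj G w t → Kept S t → Θ t ≡ Θ y → t ≡ y
    saturated⇒unique {t} wt kt Θt≡Θy with t ≟ᶠ y
    ... | yes t≡y = t≡y
    ... | no t≢y  = ⊥-elim (¬covered covered)
      where
      covered : Covered
      covered {e} e∈L with e ℕ.≟ c | e ℕ.≟ Θ y
      ... | yes e≡c | _        = inj₁ e≡c
      ... | no _    | yes refl = inj₂ (relocate-≡ wt kt t≢y Θt≡Θy)
      ... | no e≢c  | no e≢Θy  = inj₂ (covered-off e∈L e≢c e≢Θy)

  AgreeOff : Fin n → Coloring G → Coloring G → Set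
  AgreeOff w Θ θ = ∀ {t} → t ≢ w → Θ t ≡ θ t

  module Lifting {S w} (avoids : Avoids S) (w∈S : w ∈ₛ S) (slack : Slack S w) where

    private
      S-w⊆S : S - w ⊆ₛ S
      S-w⊆S = p─q⊆p S ⁅ w ⁆

      kept-w : Kept S w
      kept-w = inj₂ (inj₂ w∈S)

    Lifts : Coloring G → Coloring G → Set
    Lifts Θ θ₁ = ∃ λ Θ₁ → IsPinned S Θ₁ × EquivIn S Θ Θ₁ × AgreeOff w Θ₁ θ₁

    module OneSwap {θ θ₁ Θ} (st : StepIn (S - w) θ θ₁) (pΘ : IsPinned S Θ) (agree : AgreeOff w Θ θ) where
      open SwapIn (proj₂ (proj₂ st))

      private
        sw : ℕ → ℕ
        sw = swapColor G β γ

        kept : ∀ {t} → t ∈ₛ S → Kept S t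
        kept t∈S = inj₂ (inj₂ t∈S)

        s≢w : s ≢ w
        s≢w = x∈p-y⇒x≢y S s∈S

        K⇒≢w : ∀ {t} → t ∈ₛ K → t ≢ w
        K⇒≢w t∈K = x∈p-y⇒x≢y S (proj₁ (PathIn-last G (K⇒chain t∈K)))

        K⇒InAB : ∀ {t} → t ∈ₛ K → InAB G Θ β γ t
        K⇒InAB t∈K = resp-pair (sym (agree (K⇒≢w t∈K))) (proj₂ (PathIn-last G (K⇒chain t∈K)))

        chain-up : ∀ {t} → Chain (S - w) θ β γ s t → Chain S Θ β γ s t
        chain-up = Chain-transfer S-w⊆S (λ u∈S-w → sym (agree (x∈p-y⇒x≢y S u∈S-w)))

        chain-start : InAB G Θ β γ s → Chain (S - w) θ β γ s s
        chain-start ab = here (s∈S , resp-pair (agree s≢w) ab)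

        chain-extend : ∀ {u t} → Chain (S - w) θ β γ s u → Adj G u t → t ∈ₛ S → InAB G Θ β γ t → t ≢ w →
                       Chain (S - w) θ β γ s t
        chain-extend c ut t∈S ab t≢w = step c ut (x∈p∧x≢y⇒x∈p-y t∈S t≢w , resp-pair (agree t≢w) ab)

        θ₁-on-K : ∀ {t} → t ∈ₛ K → θ₁ t ≡ sw (Θ t)
        θ₁-on-K t∈K = trans (on-K t∈K) (cong sw (sym (agree (K⇒≢w t∈K))))

        θ₁-off-K : ∀ {t} → t ∉ₛ K → t ≢ w → θ₁ t ≡ Θ t
        θ₁-off-K t∉K t≢w = trans (off-K t∉K) (sym (agree t≢w))

        recolored-on-K : ∀ {t e} → t ∈ₛ K → (θ₁ [ w ≔ e ]) t ≡ sw (Θ t)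
        recolored-on-K t∈K = trans (updateAt-minimal _ w θ₁ (K⇒≢w t∈K)) (θ₁-on-K t∈K)

        other-color : ∀ {u t} → Adj G u t → Kept S u → Kept S t → InAB G Θ β γ u → InAB G Θ β γ t →
                       Θ t ≡ sw (Θ u)
        other-color ut ku kt abu abt = swap-other G β γ abu abt λ eq → proper pΘ ut ku kt (sym eq)

      swap-avoiding-w : (∀ {y} → Adj G w y → y ∈ₛ K → ¬ InAB G Θ β γ w) → StepIn S Θ (θ₁ [ w ≔ Θ w ])
      swap-avoiding-w detached =
        pΘ , IsPinned-recolor avoids w∈S (proj₁ (proj₂ st)) (in-list pΘ kept-w) unseen , record
          { β = β ; γ = γ ; s = s ; s∈S = S-w⊆S s∈S ; K = K
          ; K⇒chain = λ t∈K → chain-up (K⇒chain t∈K)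
          ; chain⇒K = λ c → chain⇒K (chain-down c)
          ; on-K    = recolored-on-K
          ; off-K   = off
          }
        where
        chain-down : ∀ {t} → Chain S Θ β γ s t → Chain (S - w) θ β γ s t
        chain-down (here (_ , ab)) = chain-start ab
        chain-down (step {t = t} c ut (t∈S , ab)) with t ≟ᶠ w
        ... | yes refl = contradiction ab (detached (Adj-sym G ut) (chain⇒K (chain-down c)))
        ... | no t≢w   = chain-extend (chain-down c) ut t∈S ab t≢w
        unseen : ¬ SeenAt S θ₁ w (Θ w)
        unseen (t , wt , kt , θ₁t≡Θw) with t ∈ₛ? K
        ... | yes t∈K = detached wt t∈K
                          (resp-pair (trans (sym (θ₁-on-K t∈K)) θ₁t≡Θw) (swap-preserves-pair G β γ (K⇒InAB t∈K)))
        ... | no t∉K  = proper pΘ wt kept-w kt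
                          (sym (trans (sym (θ₁-off-K t∉K (≢-sym (Adj⇒≢ G wt)))) θ₁t≡Θw))
        off : ∀ {t} → t ∉ₛ K → (θ₁ [ w ≔ Θ w ]) t ≡ Θ t
        off {t} t∉K with t ≟ᶠ w
        ... | yes refl = updateAt-updates w θ₁
        ... | no t≢w   = trans (updateAt-minimal t w θ₁ t≢w) (θ₁-off-K t∉K t≢w)

      K-neighbor-color : ∀ {y} → InAB G Θ β γ w → Adj G w y → y ∈ₛ K → Θ y ≡ sw (Θ w)
      K-neighbor-color cin wy y∈K =
        other-color wy kept-w (kept (S-w⊆S (proj₁ (PathIn-last G (K⇒chain y∈K))))) cin (K⇒InAB y∈K)

      module _ {y} (cin : InAB G Θ β γ w) (wy : Adj G w y) (y∈K : y ∈ₛ K)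
               (unique : ∀ {t} → Adj G w t → Kept S t → Θ t ≡ Θ y → t ≡ y) where

        private
          Θy≡swap : Θ y ≡ sw (Θ w)
          Θy≡swap = K-neighbor-color cin wy y∈K

        -- a chain step out of w must land on a neighbor colored sw (Θ w) = Θ y, i.e. on y ∈ K
        chain-down-through-w : ∀ {t} → Chain S Θ β γ s t → t ≡ w ⊎ Chain (S - w) θ β γ s t
        chain-down-through-w (here (_ , ab)) = inj₂ (chain-start ab)
        chain-down-through-w (step {t = t} c ut (t∈S , ab)) with t ≟ᶠ w
        ... | yes t≡w = inj₁ t≡w
        ... | no t≢w with chain-down-through-w c
        ...   | inj₂ c′   = inj₂ (chain-extend c′ ut t∈S ab t≢w)
        ...   | inj₁ refl = inj₂ (subst (Chain (S - w) θ β γ s) (sym t≡y) (K⇒chain y∈K))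
          where
          t≡y : t ≡ y
          t≡y = unique ut (kept t∈S) (trans (other-color ut kept-w (kept t∈S) cin ab) (sym Θy≡swap))

        swap-absorbing-w : Θ y ∈ L w → StepIn S Θ (θ₁ [ w ≔ Θ y ])
        swap-absorbing-w Θy∈L =
          pΘ , IsPinned-recolor avoids w∈S (proj₁ (proj₂ st)) Θy∈L unseen , record
            { β = β ; γ = γ ; s = s ; s∈S = S-w⊆S s∈S ; K = K ∪ ⁅ w ⁆
            ; K⇒chain = K′⇒chain
            ; chain⇒K = chain⇒K′
            ; on-K    = on
            ; off-K   = off
            }
          where
          unseen : ¬ SeenAt S θ₁ w (Θ y)
          unseen (t , wt , kt , θ₁t≡Θy) with t ∈ₛ? K
          ... | yes t∈K = proper pΘ wt kept-w kt
                            (sym (swap-injective G β γ (trans (sym (θ₁-on-K t∈K)) (trans θ₁t≡Θy Θy≡swap))))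
          ... | no t∉K  = t∉K (subst (_∈ₛ K) (sym (unique wt kt Θt≡Θy)) y∈K)
            where
            Θt≡Θy : Θ t ≡ Θ y
            Θt≡Θy = trans (sym (θ₁-off-K t∉K (≢-sym (Adj⇒≢ G wt)))) θ₁t≡Θy
          K′⇒chain : ∀ {t} → t ∈ₛ K ∪ ⁅ w ⁆ → Chain S Θ β γ s t
          K′⇒chain t∈K′ with x∈p∪q⁻ K ⁅ w ⁆ t∈K′
          ... | inj₁ t∈K   = chain-up (K⇒chain t∈K)
          ... | inj₂ t∈⁅w⁆ = subst (Chain S Θ β γ s) (sym (x∈⁅y⁆⇒x≡y w t∈⁅w⁆))
                               (step (chain-up (K⇒chain y∈K)) (Adj-sym G wy) (w∈S , cin))
          chain⇒K′ : ∀ {t} → Chain S Θ β γ s t → t ∈ₛ K ∪ ⁅ w ⁆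
          chain⇒K′ c with chain-down-through-w c
          ... | inj₁ refl = x∈p∪q⁺ (inj₂ (x∈⁅x⁆ w))
          ... | inj₂ c′   = x∈p∪q⁺ (inj₁ (chain⇒K c′))
          on : ∀ {t} → t ∈ₛ K ∪ ⁅ w ⁆ → (θ₁ [ w ≔ Θ y ]) t ≡ sw (Θ t)
          on {t} t∈K′ with t ≟ᶠ w | x∈p∪q⁻ K ⁅ w ⁆ t∈K′
          ... | yes refl | _          = trans (updateAt-updates w θ₁) Θy≡swap
          ... | no _     | inj₁ t∈K   = recolored-on-K t∈K
          ... | no t≢w   | inj₂ t∈⁅w⁆ = contradiction (x∈⁅y⁆⇒x≡y w t∈⁅w⁆) t≢w
          off : ∀ {t} → t ∉ₛ K ∪ ⁅ w ⁆ → (θ₁ [ w ≔ Θ y ]) t ≡ Θ t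
          off {t} t∉K′ = trans (updateAt-minimal t w θ₁ t≢w) (θ₁-off-K (t∉K′ ∘ x∈p∪q⁺ ∘ inj₁) t≢w)
            where
            t≢w : t ≢ w
            t≢w refl = t∉K′ (x∈p∪q⁺ (inj₂ (x∈⁅x⁆ w)))

    lifts-by : ∀ {Θ θ₁ e} → EquivIn S Θ (θ₁ [ w ≔ e ]) → IsPinned S (θ₁ [ w ≔ e ]) → Lifts Θ θ₁
    lifts-by {θ₁ = θ₁} Θ~Θ₁ pΘ₁ = _ , pΘ₁ , Θ~Θ₁ , λ t≢w → updateAt-minimal _ w θ₁ t≢w

    lift-step : ∀ {θ θ₁ Θ} → StepIn (S - w) θ θ₁ → IsPinned S Θ → AgreeOff w Θ θ → Lifts Θ θ₁
    lift-step {θ} {θ₁} {Θ} st pΘ agree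
      with InAB? G Θ β γ w ×-dec any? (λ y → Adj? G w y ×-dec (y ∈ₛ? K))
      where open SwapIn (proj₂ (proj₂ st))
    ... | no ¬attached = lifts-by (avoiding ◅ ε) (proj₁ (proj₂ avoiding))
      where
      avoiding : StepIn S Θ (θ₁ [ w ≔ Θ w ])
      avoiding = OneSwap.swap-avoiding-w st pΘ agree λ wy y∈K ab → ¬attached (ab , _ , wy , y∈K)
    ... | yes (cin , y , wy , y∈K) with free-color-or-saturated S Θ w (Θ w) (Θ y)
    ...   | inj₂ saturated = lifts-by (absorbing ◅ ε) (proj₁ (proj₂ absorbing))
      where
      y∈S : y ∈ₛ S
      y∈S = S-w⊆S (proj₁ (PathIn-last G (SwapIn.K⇒chain (proj₂ (proj₂ st)) y∈K)))
      open Saturation wy (proj₂ (slack⇒spare avoids pΘ y∈S slack)) saturated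
      absorbing : StepIn S Θ (θ₁ [ w ≔ Θ y ])
      absorbing = OneSwap.swap-absorbing-w st pΘ agree cin wy y∈K saturated⇒unique saturated⇒∈L
    ...   | inj₁ (e , e∈L , unseen , e≢Θw , e≢Θy) = lifts-by (recolor ◅ avoiding ◅ ε) (proj₁ (proj₂ avoiding))
      where
      open SwapIn (proj₂ (proj₂ st))
      recolor : StepIn S Θ (Θ [ w ≔ e ])
      recolor = recolor-step avoids w∈S pΘ e∈L unseen
      -- {β, γ} = {Θ w, Θ y} and e is neither, so after the recoloring w is off the chain
      detached : ∀ {y} → Adj G w y → y ∈ₛ K → ¬ InAB G (Θ [ w ≔ e ]) β γ w
      detached _ _ ab = e≢Θy (trans (swap-other G β γ cin (resp-pair (updateAt-updates w Θ) ab) e≢Θw)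
                                    (sym (OneSwap.K-neighbor-color st pΘ agree cin wy y∈K)))
      avoiding : StepIn S (Θ [ w ≔ e ]) (θ₁ [ w ≔ (Θ [ w ≔ e ]) w ])
      avoiding = OneSwap.swap-avoiding-w st (proj₁ (proj₂ recolor))
                   (λ t≢w → trans (updateAt-minimal _ w Θ t≢w) (agree t≢w)) detached

    lift : ∀ {θ θ′ Θ} → EquivIn (S - w) θ θ′ → IsPinned S Θ → AgreeOff w Θ θ → Lifts Θ θ′
    lift ε pΘ agree = _ , pΘ , ε , agree
    lift (st ◅ sts) pΘ agree with lift-step st pΘ agree
    ... | _ , p₁ , Θ~Θ₁ , agree₁ with lift sts p₁ agree₁
    ...   | Θ₂ , p₂ , Θ₁~Θ₂ , agree₂ = Θ₂ , p₂ , Θ~Θ₁ ◅◅ Θ₁~Θ₂ , agree₂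

  Avoids-antitone : ∀ {S S′} → S′ ⊆ₛ S → Avoids S → Avoids S′
  Avoids-antitone S′⊆S (v∉S , x∉S) = v∉S ∘ S′⊆S , x∉S ∘ S′⊆S

  Anchored : Subset n → Set
  Anchored S = ∀ {u} → u ∈ₛ S → ∃ λ z → Slack S z × PathIn G (_∈ₛ S) u z

  Anchored-remove : ∀ {S w} → Avoids S → w ∈ₛ S → Anchored S → Anchored (S - w)
  Anchored-remove {S} {w} avoids w∈S anchored u∈S-w with anchored (p─q⊆p S ⁅ w ⁆ u∈S-w)
  ... | z , slack , path with path-avoiding-or-hitting G path u∈S-w
  ...   | inj₁ path′          = z , slack′ slack , path′
    where
    slack′ : Slack S z → Slack (S - w) z
    slack′ (inj₁ (t , zt , t∉S , t≢v , t≢x)) = inj₁ (t , zt , t∉S ∘ p─q⊆p S ⁅ w ⁆ , t≢v , t≢x)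
    slack′ (inj₂ zv-zx)                      = inj₂ zv-zx
  ...   | inj₂ (y , path′ , yw) =
    y , inj₁ (w , yw , (λ w∈S-w → x∈p-y⇒x≢y S w∈S-w refl) , ∈⇒≢v avoids w∈S , ∈⇒≢x avoids w∈S) , path′

  Reaches : Subset n → Coloring G → Coloring G → Set
  Reaches S φ ψ = ∃ λ ψ′ → IsPinned S ψ′ × EquivIn S φ ψ′ × (∀ {t} → Kept S t → ψ′ t ≡ ψ t)

  Reaches-insert : ∀ {S w φ ψ} → Avoids S → w ∈ₛ S → Slack S w → IsPinned S φ → IsPinned S ψ →
                   Reaches (S - w) φ ψ → Reaches S φ ψ
  Reaches-insert {S} {w} {φ} {ψ} avoids w∈S slack pφ pψ (θ′ , _ , φ~θ′ , θ′≈ψ)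
    with Lifting.lift avoids w∈S slack φ~θ′ pφ (λ _ → refl)
  ... | Θ′ , pΘ′ , φ~Θ′ , Θ′≈θ′ = Θ′ [ w ≔ ψ w ] , proj₁ (proj₂ final) , φ~Θ′ ◅◅ (final ◅ ε) , agree
    where
    kept-w : Kept S w
    kept-w = inj₂ (inj₂ w∈S)
    Θ′≈ψ : ∀ {t} → Kept S t → t ≢ w → Θ′ t ≡ ψ t
    Θ′≈ψ kt t≢w = trans (Θ′≈θ′ t≢w) (θ′≈ψ (Kept-remove kt t≢w))
    unseen : ¬ SeenAt S Θ′ w (ψ w)
    unseen (t , wt , kt , Θ′t≡ψw) =
      proper pψ wt kept-w kt (sym (trans (sym (Θ′≈ψ kt (≢-sym (Adj⇒≢ G wt)))) Θ′t≡ψw))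
    final : StepIn S Θ′ (Θ′ [ w ≔ ψ w ])
    final = recolor-step avoids w∈S pΘ′ (in-list pψ kept-w) unseen
    agree : ∀ {t} → Kept S t → (Θ′ [ w ≔ ψ w ]) t ≡ ψ t
    agree {t} kt with t ≟ᶠ w
    ... | yes refl = updateAt-updates w Θ′
    ... | no t≢w   = trans (updateAt-minimal t w Θ′ t≢w) (Θ′≈ψ kt t≢w)

  pinned-reaches : ∀ {S φ ψ} → Acc _<_ ∣ S ∣ → Avoids S → Anchored S →
                   IsPinned S φ → IsPinned S ψ → Reaches S φ ψ
  pinned-reaches {S} {φ} {ψ} (acc smaller) avoids anchored pφ pψ with nonempty? S
  ... | no empty = φ , pφ , ε , agree
    where
    agree : ∀ {t} → Kept S t → φ t ≡ ψ t
    agree (inj₁ refl)        = trans (v↦α pφ) (sym (v↦α pψ))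
    agree (inj₂ (inj₁ refl)) = trans (x↦α pφ) (sym (x↦α pψ))
    agree (inj₂ (inj₂ t∈S))  = contradiction (_ , t∈S) empty
  ... | yes (_ , u∈S) with anchored u∈S
  ...   | w , slack , path = Reaches-insert avoids w∈S slack pφ pψ
            (pinned-reaches (smaller (x∈p⇒∣p-x∣<∣p∣ w∈S)) (Avoids-antitone S-w⊆S avoids)
              (Anchored-remove avoids w∈S anchored) (IsPinned-antitone S-w⊆S pφ) (IsPinned-antitone S-w⊆S pψ))
    where
    w∈S : w ∈ₛ S
    w∈S = PathIn-last G path
    S-w⊆S : S - w ⊆ₛ S
    S-w⊆S = p─q⊆p S ⁅ w ⁆

  S₀ : Subset n
  S₀ = ⊤ - v - x

  ∈S₀ : ∀ {u} → u ≢ v → u ≢ x → u ∈ₛ S₀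
  ∈S₀ u≢v u≢x = x∈p∧x≢y⇒x∈p-y (x∈p∧x≢y⇒x∈p-y ∈⊤ u≢v) u≢x

  avoids₀ : Avoids S₀
  avoids₀ = (λ v∈S₀ → x∈p-y⇒x≢y ⊤ (p─q⊆p (⊤ - v) ⁅ x ⁆ v∈S₀) refl) , (λ x∈S₀ → x∈p-y⇒x≢y (⊤ - v) x∈S₀ refl)

  kept₀ : ∀ u → Kept S₀ u
  kept₀ u with u ≟ᶠ v | u ≟ᶠ x
  ... | yes u≡v | _       = inj₁ u≡v
  ... | no _    | yes u≡x = inj₂ (inj₁ u≡x)
  ... | no u≢v  | no u≢x  = inj₂ (inj₂ (∈S₀ u≢v u≢x))

  anchored₀ : ∀ {w} → Adj G w v → Adj G w x → ConnectedOn G (Minus2 G v x) → Anchored S₀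
  anchored₀ {w} wv wx connected {u} u∈S₀ =
    w , inj₂ (wv , wx) ,
    PathIn-map G (λ (t≢v , t≢x) → ∈S₀ t≢v t≢x)
      (connected u w (∈⇒≢v avoids₀ u∈S₀ , ∈⇒≢x avoids₀ u∈S₀) (Adj⇒≢ G wv , Adj⇒≢ G wx))

  IsLColoring⇒IsPinned : ∀ {φ} → IsLColoring G L φ → φ v ≡ α → φ x ≡ α → IsPinned S₀ φ
  IsLColoring⇒IsPinned (proper′ , in-list′) φv≡α φx≡α = record
    { v↦α = φv≡α ; x↦α = φx≡α ; proper = λ ut _ _ → proper′ _ _ ut ; in-list = λ {u} _ → in-list′ u }

  IsPinned⇒IsLColoring : ∀ {φ} → IsPinned S₀ φ → IsLColoring G L φ
  IsPinned⇒IsLColoring p = (λ u t ut → proper p ut (kept₀ u) (kept₀ t)) , λ u → in-list p (kept₀ u)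

  SwapIn₀⇒KempeSwap : ∀ {φ ψ} → IsPinned S₀ φ → IsPinned S₀ ψ → SwapIn S₀ φ ψ → KempeSwap G φ ψ
  SwapIn₀⇒KempeSwap {φ} {ψ} pφ pψ swap = β , γ , s , (λ _ r → on-K (chain⇒K (to-chain r))) , off
    where
    open SwapIn swap
    -- a chain leaving S₀ would make ψ improper at the exit edge
    to-chain : ∀ {t} → Reach G φ β γ s t → Chain S₀ φ β γ s t
    to-chain (here ab) = here (s∈S , ab)
    to-chain (step {u} {t} r ut ab) with t ∈ₛ? S₀
    ... | yes t∈S₀ = step (to-chain r) ut (t∈S₀ , ab)
    ... | no t∉S₀  = ⊥-elim (proper pψ ut (kept₀ u) (kept₀ t) ψu≡ψt)
      where
      open ≡-Reasoning
      φu≡swap : φ u ≡ swapColor G β γ (φ t)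
      φu≡swap = swap-other G β γ ab (proj₂ (PathIn-last G (to-chain r))) (proper pφ ut (kept₀ u) (kept₀ t))
      t∉K : t ∉ₛ K
      t∉K t∈K = t∉S₀ (proj₁ (PathIn-last G (K⇒chain t∈K)))
      ψu≡ψt : ψ u ≡ ψ t
      ψu≡ψt = begin
        ψ u                                          ≡⟨ on-K (chain⇒K (to-chain r)) ⟩
        swapColor G β γ (φ u)                        ≡⟨ cong (swapColor G β γ) φu≡swap ⟩
        swapColor G β γ (swapColor G β γ (φ t))      ≡⟨ swap-involutive G β γ (φ t) ⟩
        φ t                                          ≡⟨ off-K t∉K ⟨
        ψ t                                          ∎
    from-chain : ∀ {t} → Chain S₀ φ β γ s t → Reach G φ β γ s t
    from-chain (here (_ , ab))      = here ab
    from-chain (step c ut (_ , ab)) = step (from-chain c) ut ab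
    off : ∀ t → ¬ Reach G φ β γ s t → ψ t ≡ φ t
    off t ¬r with t ∈ₛ? K
    ... | yes t∈K = contradiction (from-chain (K⇒chain t∈K)) ¬r
    ... | no t∉K  = off-K t∉K

  EquivIn₀⇒LEquivalent : ∀ {φ ψ} → EquivIn S₀ φ ψ → LEquivalent G L φ ψ
  EquivIn₀⇒LEquivalent = Star-map λ (pφ , pψ , swap) →
    IsPinned⇒IsLColoring pφ , IsPinned⇒IsLColoring pψ , SwapIn₀⇒KempeSwap pφ pψ swap

  pinned-colorings-mix : ∀ {w} → Adj G w v → Adj G w x → ConnectedOn G (Minus2 G v x) →
                         Mixes G L (λ φ → 𝓛 G L v α φ × 𝓛 G L x α φ)
  pinned-colorings-mix wv wx connected φ ψ Lφ Lψ ((_ , φv≡α) , (_ , φx≡α)) ((_ , ψv≡α) , (_ , ψx≡α))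
    with pinned-reaches (<-wellFounded _) avoids₀ (anchored₀ wv wx connected)
           (IsLColoring⇒IsPinned Lφ φv≡α φx≡α) (IsLColoring⇒IsPinned Lψ ψv≡α ψx≡α)
  ... | ψ′ , pψ′ , φ~ψ′ , ψ′≈ψ =
    EquivIn₀⇒LEquivalent φ~ψ′ ◅◅
      (IsPinned⇒IsLColoring pψ′ , Lψ , KempeSwap-≗ G v (λ t → sym (ψ′≈ψ (kept₀ t)))) ◅ ε

corollary9 : ∀ {n} (G : Graph n) (L : ListAssignment G) →
    IsDegreeAssignment G L →
    (v w x : Fin n) → v ≢ x →
    Adj G w v → Adj G w x → E G v x ≡ false →
    ConnectedOn G (Minus2 G v x) →
    (α : ℕ) → α ∈ L v → α ∈ L x →
    Mixes G L (λ φ → 𝓛 G L v α φ × 𝓛 G L x α φ)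
-- vx ∉ E(G) and α ∈ L(v) ∩ L(x) only serve to make the set nonempty; the proof does not use them.
corollary9 G L L-deg v w x v≢x wv wx _ connected α _ _ =
  Pinned.pinned-colorings-mix G L L-deg v x v≢x α wv wx connected
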